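{- Let $i,j$ be positive integers. If the phylogeny graph of an $(i,j)$ digraph contains an induced subgraph isomorphic to $K_{1,l}$ for some positive integer $l$, then $l \leq j+1$. Furthermore, $K_{1,j+1}$ is $(i,j)$ realizable, i.e. it is isomorphic to an induced subgraph of the phylogeny graph of some $(i,j)$ digraph.
   Context: An $(i,j)$ digraph is an acyclic digraph in which every vertex has indegree at most $i$ and outdegree at most $j$. The phylogeny graph $P(D)$ has vertex set $V(D)$ and an edge between distinct $u,v$ iff $(u,v)\in A(D)$ or $(v,u)\in A(D)$ or $u,v$ have a common out-neighbor in $D$. $K_{1,l}$ is the star with $l$ leaves. -}

module Defs where

open import Data.Nat using (ℕ; zero; suc; _+_; _≤_)
open import Data.Fin using (Fin; zero; suc)
open import Data.Bool using (Bool; true; false; if_then_else_)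
open import Data.Product using (Σ; ∃; _×_; _,_)
open import Data.Sum using (_⊎_)
open import Relation.Binary.PropositionalEquality using (_≡_; _≢_)
open import Relation.Nullary using (¬_)
open import Function.Definitions using (Injective)
open import Function.Bundles using (_⇔_)

Digraph : ℕ → Set
Digraph n = Fin n → Fin n → Bool

Arc : ∀ {n} → Digraph n → Fin n → Fin n → Set
Arc D u v = D u v ≡ true

count : ∀ {n} → (Fin n → Bool) → ℕ
count {zero}  p = 0
count {suc n} p = (if p zero then 1 else 0) + count (λ x → p (suc x))

indegree : ∀ {n} → Digraph n → Fin n → ℕ
indegree D v = count (λ u → D u v)

outdegree : ∀ {n} → Digraph n → Fin n → ℕ
outdegree D u = count (λ v → D u v)

data Path {n} (D : Digraph n) : Fin n → Fin n → Set where
  step : ∀ {u v} → Arc D u v → Path D u v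
  _∷_  : ∀ {u w v} → Arc D u w → Path D w v → Path D u v

Acyclic : ∀ {n} → Digraph n → Set
Acyclic D = ∀ v → ¬ Path D v v

IsIJDigraph : ℕ → ℕ → ∀ {n} → Digraph n → Set
IsIJDigraph i j D = Acyclic D × (∀ v → indegree D v ≤ i) × (∀ v → outdegree D v ≤ j)

PhyloEdge : ∀ {n} → Digraph n → Fin n → Fin n → Set
PhyloEdge D u v =
  u ≢ v × (Arc D u v ⊎ Arc D v u ⊎ (∃ λ w → Arc D u w × Arc D v w))

StarAdj : (l : ℕ) → Fin (suc l) → Fin (suc l) → Set
StarAdj l a b = (a ≡ zero × b ≢ zero) ⊎ (b ≡ zero × a ≢ zero)

IsoToInducedSubgraph : ∀ {m n} → (Fin m → Fin m → Set) → (Fin n → Fin n → Set) → Set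
IsoToInducedSubgraph {m} {n} G H =
  Σ (Fin m → Fin n) λ f → Injective _≡_ _≡_ f × (∀ a b → G a b ⇔ H (f a) (f b))

IJRealizable : ℕ → ℕ → ∀ {m} → (Fin m → Fin m → Set) → Set
IJRealizable i j G =
  Σ ℕ λ n → Σ (Digraph n) λ D → IsIJDigraph i j D × IsoToInducedSubgraph G (PhyloEdge D)

-- Fix a vertex c of an (i,j) digraph D. Each neighbour u of c in P(D) has a witness
-- in N⁺(c) ∪ {c}: u itself if c → u, c if u → c, and a common out-neighbour
-- otherwise. Two vertices with the same witness are adjacent in P(D), so the leaves
-- of an induced star centred at c have distinct witnesses, and l ≤ 1 + outdegree c.
-- The bound is attained by the digraph x → c → y₁, …, c → y_j, whose phylogeny graph
-- is the star K_{1,j+1} centred at c.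
module Submission where

open import Defs
open import Data.Nat using (ℕ; zero; suc; _+_; _≤_; _<_; z≤n; s≤s)
open import Data.Nat.Properties using (+-suc; +-comm; ≤-refl; ≤-trans; <-irrefl; <-trans)
open import Data.Fin using (Fin; zero; suc)
open import Data.Fin.Properties using (suc-injective; _≟_)
open import Data.Bool using (Bool; true; false; if_then_else_)
open import Data.Product using (Σ; ∃; _×_; _,_; proj₂)
open import Data.Sum using (_⊎_; inj₁; inj₂)
open import Data.Empty using (⊥-elim)
open import Function using (_∘_; id)
open import Function.Definitions using (Injective)
open import Function.Bundles using (_⇔_; mk⇔; Equivalence)
open import Relation.Nullary using (¬_; yes; no; does; contradiction)
open import Relation.Binary.PropositionalEquality using (_≡_; _≢_; refl; sym; trans; cong; subst)

_─_ : ∀ {m} → (Fin m → Bool) → Fin m → Fin m → Bool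
(P ─ x) y = if does (y ≟ x) then false else P y

count-─ : ∀ {m} (P : Fin m → Bool) {x} → P x ≡ true → count P ≡ suc (count (P ─ x))
count-─ P {zero}  Px rewrite Px = refl
count-─ P {suc x} Px =
  trans (cong ((if P zero then 1 else 0) +_) (count-─ (P ∘ suc) Px)) (+-suc _ _)

injection⇒≤count : ∀ {l m} (P : Fin m → Bool) (h : Fin l → Fin m) →
  Injective _≡_ _≡_ h → (∀ a → P (h a) ≡ true) → l ≤ count P
injection⇒≤count {zero}  P h inj ok = z≤n
injection⇒≤count {suc l} P h inj ok =
  subst (suc l ≤_) (sym (count-─ P (ok zero)))
    (s≤s (injection⇒≤count (P ─ h zero) (h ∘ suc) (suc-injective ∘ inj) ok─))
  where
  ok─ : ∀ a → (P ─ h zero) (h (suc a)) ≡ true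
  ok─ a with h (suc a) ≟ h zero
  ... | yes e = contradiction (inj e) λ ()
  ... | no _  = ok (suc a)

count-false : ∀ {m} (P : Fin m → Bool) → (∀ x → P x ≡ false) → count P ≡ 0
count-false {zero}  P _ = refl
count-false {suc m} P none rewrite none zero = count-false (P ∘ suc) (none ∘ suc)

count-true : ∀ m → count {m} (λ _ → true) ≡ m
count-true zero    = refl
count-true (suc m) = cong suc (count-true m)

rank⇒acyclic : ∀ {n} (D : Digraph n) (rank : Fin n → ℕ) →
  (∀ {u v} → Arc D u v → rank u < rank v) → Acyclic D
rank⇒acyclic D rank arc-rank v p = <-irrefl refl (path-rank p)
  where
  path-rank : ∀ {u w} → Path D u w → rank u < rank w
  path-rank (step a) = arc-rank a
  path-rank (a ∷ p)  = <-trans (arc-rank a) (path-rank p)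

module PhyloNeighbourhood {n} (D : Digraph n) (c : Fin n) where

  PhyloRelated : Fin n → Set
  PhyloRelated u = Arc D c u ⊎ Arc D u c ⊎ (∃ λ w → Arc D c w × Arc D u w)

  -- suc w stands for the out-neighbour w of c, and zero for c itself.
  ClosedOutNeighbour : Fin (suc n) → Bool
  ClosedOutNeighbour zero    = true
  ClosedOutNeighbour (suc w) = D c w

  witness : ∀ {u} → PhyloRelated u → Fin (suc n)
  witness {u} (inj₁ _)          = suc u
  witness (inj₂ (inj₁ _))       = zero
  witness (inj₂ (inj₂ (w , _))) = suc w

  witness-closedOut : ∀ {u} (r : PhyloRelated u) → ClosedOutNeighbour (witness r) ≡ true
  witness-closedOut (inj₁ cu)                 = cu
  witness-closedOut (inj₂ (inj₁ _))           = refl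
  witness-closedOut (inj₂ (inj₂ (_ , cw , _))) = cw

  same-witness⇒phyloEdge : ∀ {u u′} (r : PhyloRelated u) (r′ : PhyloRelated u′) →
    witness r ≡ witness r′ → u ≢ u′ → PhyloEdge D u u′
  same-witness⇒phyloEdge (inj₁ _) (inj₁ _) refl u≢u′ = ⊥-elim (u≢u′ refl)
  same-witness⇒phyloEdge (inj₁ _) (inj₂ (inj₂ (_ , _ , u′w))) refl u≢u′ =
    u≢u′ , inj₂ (inj₁ u′w)
  same-witness⇒phyloEdge (inj₂ (inj₁ uc)) (inj₂ (inj₁ u′c)) refl u≢u′ =
    u≢u′ , inj₂ (inj₂ (c , uc , u′c))
  same-witness⇒phyloEdge (inj₂ (inj₂ (_ , _ , uw))) (inj₁ _) refl u≢u′ = u≢u′ , inj₁ uw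
  same-witness⇒phyloEdge (inj₂ (inj₂ (w , _ , uw))) (inj₂ (inj₂ (.w , _ , u′w))) refl u≢u′ =
    u≢u′ , inj₂ (inj₂ (w , uw , u′w))
  same-witness⇒phyloEdge (inj₁ _)        (inj₂ (inj₁ _)) ()
  same-witness⇒phyloEdge (inj₂ (inj₁ _)) (inj₁ _)        ()
  same-witness⇒phyloEdge (inj₂ (inj₁ _)) (inj₂ (inj₂ _)) ()
  same-witness⇒phyloEdge (inj₂ (inj₂ _)) (inj₂ (inj₁ _)) ()

  independent-neighbours≤1+outdegree : ∀ {l} (g : Fin l → Fin n) → Injective _≡_ _≡_ g →
    (∀ a → PhyloEdge D c (g a)) → (∀ a b → ¬ PhyloEdge D (g a) (g b)) →
    l ≤ suc (outdegree D c)
  independent-neighbours≤1+outdegree g g-inj adjacent independent =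
    injection⇒≤count ClosedOutNeighbour (witness ∘ related) witness-inj
      (witness-closedOut ∘ related)
    where
    related : ∀ a → PhyloRelated (g a)
    related a = proj₂ (adjacent a)

    witness-inj : Injective _≡_ _≡_ (witness ∘ related)
    witness-inj {a} {b} same with a ≟ b
    ... | yes a≡b = a≡b
    ... | no  a≢b = ⊥-elim (independent a b
            (same-witness⇒phyloEdge (related a) (related b) same (a≢b ∘ g-inj)))

induced-star≤1+outdegree : ∀ {n} (D : Digraph n) {l} →
  IsoToInducedSubgraph (StarAdj l) (PhyloEdge D) → Σ (Fin n) λ c → l ≤ suc (outdegree D c)
induced-star≤1+outdegree D (f , f-inj , iso) =
  f zero ,
  independent-neighbours≤1+outdegree (f ∘ suc) (suc-injective ∘ f-inj) adjacent independent
  where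
  open PhyloNeighbourhood D (f zero)

  adjacent : ∀ a → PhyloEdge D (f zero) (f (suc a))
  adjacent a = Equivalence.to (iso zero (suc a)) (inj₁ (refl , λ ()))

  independent : ∀ a b → ¬ PhyloEdge D (f (suc a)) (f (suc b))
  independent a b e with Equivalence.from (iso (suc a) (suc b)) e
  ... | inj₁ (() , _)
  ... | inj₂ (() , _)

module StarRealizer (j : ℕ) where

  -- zero is the centre, suc zero its in-neighbour, suc (suc k) its out-neighbours.
  D : Digraph (suc (suc j))
  D (suc zero) zero    = true
  D zero (suc (suc _)) = true
  D _ _                = false

  rank : Fin (suc (suc j)) → ℕ
  rank (suc zero)    = 0
  rank zero          = 1
  rank (suc (suc _)) = 2

  arc-rank : ∀ {u v} → Arc D u v → rank u < rank v
  arc-rank {suc zero} {zero}      _ = s≤s z≤n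
  arc-rank {zero} {suc (suc _)}   _ = s≤s (s≤s z≤n)
  arc-rank {zero} {zero}          ()
  arc-rank {zero} {suc zero}      ()
  arc-rank {suc zero} {suc _}     ()
  arc-rank {suc (suc _)} {_}      ()

  indegree≤ : ∀ {i} → 1 ≤ i → ∀ v → indegree D v ≤ i
  indegree≤ 1≤i zero
    rewrite count-false (λ x → D (suc (suc x)) zero) (λ _ → refl) = 1≤i
  indegree≤ 1≤i (suc zero)
    rewrite count-false (λ x → D (suc (suc x)) (suc zero)) (λ _ → refl) = z≤n
  indegree≤ 1≤i (suc (suc k))
    rewrite count-false (λ x → D (suc x) (suc (suc k))) (λ { zero → refl ; (suc _) → refl }) = 1≤i

  outdegree≤ : 1 ≤ j → ∀ v → outdegree D v ≤ j
  outdegree≤ 1≤j zero rewrite count-true j = ≤-refl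
  outdegree≤ 1≤j (suc zero)
    rewrite count-false (λ x → D (suc zero) (suc (suc x))) (λ _ → refl) = 1≤j
  outdegree≤ 1≤j (suc (suc k))
    rewrite count-false (λ x → D (suc (suc k)) (suc (suc x))) (λ _ → refl) = z≤n

  leaves-independent : ∀ x y → ¬ PhyloEdge D (suc x) (suc y)
  leaves-independent zero zero          (x≢y , _) = x≢y refl
  leaves-independent zero (suc _)       (_ , inj₁ ())
  leaves-independent zero (suc _)       (_ , inj₂ (inj₁ ()))
  leaves-independent zero (suc _)       (_ , inj₂ (inj₂ (zero , _ , ())))
  leaves-independent zero (suc _)       (_ , inj₂ (inj₂ (suc _ , () , _)))
  leaves-independent (suc _) _          (_ , inj₁ ())
  leaves-independent (suc _) zero       (_ , inj₂ (inj₁ ()))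
  leaves-independent (suc _) (suc _)    (_ , inj₂ (inj₁ ()))
  leaves-independent (suc _) _          (_ , inj₂ (inj₂ (_ , () , _)))

  star≅phylo : ∀ a b → StarAdj (suc j) a b ⇔ PhyloEdge D a b
  star≅phylo zero zero =
    mk⇔ (λ { (inj₁ (_ , ne)) → ⊥-elim (ne refl) ; (inj₂ (_ , ne)) → ⊥-elim (ne refl) })
        (λ { (ne , _) → ⊥-elim (ne refl) })
  star≅phylo zero (suc zero)          = mk⇔ (λ _ → (λ ()) , inj₂ (inj₁ refl)) (λ _ → inj₁ (refl , λ ()))
  star≅phylo zero (suc (suc _))       = mk⇔ (λ _ → (λ ()) , inj₁ refl)        (λ _ → inj₁ (refl , λ ()))
  star≅phylo (suc zero) zero          = mk⇔ (λ _ → (λ ()) , inj₁ refl)        (λ _ → inj₂ (refl , λ ()))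
  star≅phylo (suc (suc _)) zero       = mk⇔ (λ _ → (λ ()) , inj₂ (inj₁ refl)) (λ _ → inj₂ (refl , λ ()))
  star≅phylo (suc x) (suc y) =
    mk⇔ (λ { (inj₁ (() , _)) ; (inj₂ (() , _)) }) (⊥-elim ∘ leaves-independent x y)

  realizes-star : ∀ {i} → 1 ≤ i → 1 ≤ j → IJRealizable i j (StarAdj (suc j))
  realizes-star 1≤i 1≤j =
    suc (suc j) , D ,
    (rank⇒acyclic D rank arc-rank , indegree≤ 1≤i , outdegree≤ 1≤j) ,
    id , id , star≅phylo

proposition3p2 : (i j : ℕ) → 1 ≤ i → 1 ≤ j →
    ((n : ℕ) (D : Digraph n) → IsIJDigraph i j D →
      (l : ℕ) → 1 ≤ l → IsoToInducedSubgraph (StarAdj l) (PhyloEdge D) → l ≤ j + 1)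
    × IJRealizable i j (StarAdj (j + 1))
proposition3p2 i j 1≤i 1≤j = star-bound , realizable
  where
  star-bound : (n : ℕ) (D : Digraph n) → IsIJDigraph i j D →
    (l : ℕ) → 1 ≤ l → IsoToInducedSubgraph (StarAdj l) (PhyloEdge D) → l ≤ j + 1
  star-bound n D (_ , _ , outdegree≤j) l _ star
    with c , l≤1+outdegree ← induced-star≤1+outdegree D star =
    subst (l ≤_) (+-comm 1 j) (≤-trans l≤1+outdegree (s≤s (outdegree≤j c)))

  realizable : IJRealizable i j (StarAdj (j + 1))
  realizable = subst (λ k → IJRealizable i j (StarAdj k)) (+-comm 1 j)
    (StarRealizer.realizes-star j 1≤i 1≤j)
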